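{- Let $A,B\in\mathbb{R}^{n\times n}$ be tropical matrices such that the tropical product $AB$ is sign-nonsingular, and let $\sigma\in\Sigma(A)$ and $\tau\in\Sigma(B)$. Then $\tau\sigma\in\Sigma(AB)$ and $\operatorname{perm}(A)+\operatorname{perm}(B)=\operatorname{perm}(AB)$.
   Context: Tropical arithmetic on $\mathbb{R}$: $a\oplus b=\min\{a,b\}$, $a\otimes b=a+b$. The tropical product of matrices has $(i,j)$ entry $[AB]_{ij}=\min_{t=1}^n\{A_{it}+B_{tj}\}$. The tropical permanent is $\operatorname{perm}(A)=\min_{\sigma}\{A_{1\sigma(1)}+\cdots+A_{n\sigma(n)}\}$ over all permutations $\sigma$ of $\{1,\ldots,n\}$, and $\Sigma(A)$ is the set of permutations attaining this minimum. $A$ is sign-nonsingular if all permutations in $\Sigma(A)$ have the same parity (otherwise sign-singular). $\tau\sigma$ denotes the composition $i\mapsto\tau(\sigma(i))$. -}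

module Defs where

open import Level using (0ℓ)
open import Data.Nat as ℕ using (ℕ; zero; suc)
open import Data.Fin using (Fin; zero; suc; _<?_)
open import Data.Fin.Permutation using (Permutation′; _⟨$⟩ʳ_; _∘ₚ_)
open import Data.Product using (Σ; ∃; _×_; _,_)
open import Data.Sum using (_⊎_)
open import Data.Bool using (Bool; true; false; if_then_else_; _∧_)
open import Relation.Nullary using (¬_; Dec; yes; no)
open import Relation.Binary.PropositionalEquality using (_≡_; _≢_)
open import Relation.Nullary.Decidable using (⌊_⌋)

-- An axiomatic model of the real numbers: a Dedekind-complete ordered field.
-- (agda-stdlib has no real numbers; any such structure is isomorphic to ℝ.)
record RealNumbers : Set₁ where
  infixl 6 _+_
  infixl 7 _*_
  infix 4 _≤_
  field
    ℝ    : Set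
    _+_  : ℝ → ℝ → ℝ
    _*_  : ℝ → ℝ → ℝ
    -_   : ℝ → ℝ
    0ℝ   : ℝ
    1ℝ   : ℝ
    _≤_  : ℝ → ℝ → Set
    +-assoc   : ∀ x y z → (x + y) + z ≡ x + (y + z)
    +-comm    : ∀ x y → x + y ≡ y + x
    +-identityʳ : ∀ x → x + 0ℝ ≡ x
    +-inverseʳ  : ∀ x → x + (- x) ≡ 0ℝ
    *-assoc   : ∀ x y z → (x * y) * z ≡ x * (y * z)
    *-comm    : ∀ x y → x * y ≡ y * x
    *-identityʳ : ∀ x → x * 1ℝ ≡ x
    *-inverseʳ  : ∀ x → x ≢ 0ℝ → Σ ℝ (λ y → x * y ≡ 1ℝ)
    distribˡ  : ∀ x y z → x * (y + z) ≡ (x * y) + (x * z)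
    0≢1       : 0ℝ ≢ 1ℝ
    ≤-refl    : ∀ x → x ≤ x
    ≤-antisym : ∀ {x y} → x ≤ y → y ≤ x → x ≡ y
    ≤-trans   : ∀ {x y z} → x ≤ y → y ≤ z → x ≤ z
    ≤-total   : ∀ x y → x ≤ y ⊎ y ≤ x
    +-monoˡ-≤ : ∀ {x y} z → x ≤ y → x + z ≤ y + z
    *-nonneg  : ∀ {x y} → 0ℝ ≤ x → 0ℝ ≤ y → 0ℝ ≤ x * y
    complete  : (P : ℝ → Set) → Σ ℝ P → Σ ℝ (λ b → ∀ x → P x → x ≤ b) →
                Σ ℝ (λ s → (∀ x → P x → x ≤ s) × (∀ b → (∀ x → P x → x ≤ b) → s ≤ b))

module Tropical (R : RealNumbers) where
  open RealNumbers R

  Matrix : ℕ → Set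
  Matrix n = Fin n → Fin n → ℝ

  -- tropical addition a ⊕ b = min {a , b}
  min : ℝ → ℝ → ℝ
  min a b with ≤-total a b
  ... | Data.Sum.inj₁ _ = a
  ... | Data.Sum.inj₂ _ = b

  minFin : (m : ℕ) → (Fin (suc m) → ℝ) → ℝ
  minFin zero    f = f zero
  minFin (suc m) f = min (f zero) (minFin m (λ t → f (suc t)))

  sumFin : (n : ℕ) → (Fin n → ℝ) → ℝ
  sumFin zero    f = 0ℝ
  sumFin (suc n) f = f zero + sumFin n (λ i → f (suc i))

  _⊗_ : ∀ {n} → Matrix n → Matrix n → Matrix n
  _⊗_ {suc m} A B i j = minFin m (λ t → A i t + B t j)

  weight : ∀ {n} → Matrix n → Permutation′ n → ℝ
  weight {n} A σ = sumFin n (λ i → A i (σ ⟨$⟩ʳ i))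

  _∈Σ_ : ∀ {n} → Permutation′ n → Matrix n → Set
  _∈Σ_ {n} σ A = ∀ (ρ : Permutation′ n) → weight A σ ≤ weight A ρ

  IsPerm : ∀ {n} → Matrix n → ℝ → Set
  IsPerm {n} A p = Σ (Permutation′ n) (λ σ → weight A σ ≡ p) × (∀ ρ → p ≤ weight A ρ)

countFin : (n : ℕ) → (Fin n → Bool) → ℕ
countFin zero    f = zero
countFin (suc n) f = (if f zero then 1 else 0) ℕ.+ countFin n (λ i → f (suc i))

sumℕ : (n : ℕ) → (Fin n → ℕ) → ℕ
sumℕ zero    f = zero
sumℕ (suc n) f = f zero ℕ.+ sumℕ n (λ i → f (suc i))

inversions : ∀ {n} → Permutation′ n → ℕ
inversions {n} σ =
  sumℕ n (λ i → countFin n (λ j → ⌊ i <? j ⌋ ∧ ⌊ (σ ⟨$⟩ʳ j) <? (σ ⟨$⟩ʳ i) ⌋))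

parity : ∀ {n} → Permutation′ n → ℕ
parity σ = inversions σ ℕ.% 2

module TropicalSign (R : RealNumbers) where
  open Tropical R

  SignNonsingular : ∀ {n} → Matrix n → Set
  SignNonsingular {n} A =
    ∀ (ρ ρ′ : Permutation′ n) → ρ ∈Σ A → ρ′ ∈Σ A → parity ρ ≡ parity ρ′

module Submission where

open import Defs
open import Data.Nat using (ℕ)
open import Data.Fin.Permutation using (Permutation′; _∘ₚ_)
open import Data.Product using (_×_)
open import Relation.Binary.PropositionalEquality using (_≡_)
open import Data.Product using (_,_)
open import Relation.Binary.PropositionalEquality using (refl)

-- Upper bound: routing row i of A ⊗ B through the intermediate index σ i gives
--   weight (A ⊗ B) (σ ∘ₚ τ) ≤ weight A σ + weight B τ   for all σ, τ.
-- Lower bound: take an optimal permutation ρ₀ of A ⊗ B and, for every row i,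
-- an index f i at which the entry (i , ρ₀ i) of A ⊗ B is attained, so that
--   weight (A ⊗ B) ρ₀ = Σᵢ A i (f i) + Σᵢ B (f i) (ρ₀ i).
-- If f i ≡ f j for some i ≢ j, then ρ₀ composed with the transposition (i j)
-- costs no more, hence is optimal too, but has the other parity; this
-- contradicts sign-nonsingularity. So f is a permutation φ and the right-hand
-- side is weight A φ + weight B (φ⁻¹ ∘ ρ₀) ≥ perm A + perm B. Together the
-- bounds give both the optimality of σ ∘ₚ τ and perm A + perm B = perm (A ⊗ B).

module FiniteMaps where
  open import Data.Nat using (suc)
  open import Data.Nat.Properties using (n<1+n)
  open import Data.Fin using (Fin; punchOut; _≟_; _<_)
  open import Data.Fin.Properties using (any?; pigeonhole; punchOut-injective; <⇒≢)
  open import Data.Fin.Permutation using (_⟨$⟩ʳ_; _⟨$⟩ˡ_; permutation; inverseˡ)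
  import Data.Fin.Permutation.Components as PC
  open import Data.Product using (∃; ∃₂; proj₁; proj₂)
  open import Data.Empty using (⊥-elim)
  open import Function using (_∘_; Injective)
  open import Relation.Nullary using (¬_; yes; no)
  open import Relation.Binary.PropositionalEquality

  injective⇒surjective : ∀ {n} (f : Fin n → Fin n) → Injective _≡_ _≡_ f → ∀ y → ∃ λ x → f x ≡ y
  injective⇒surjective {suc m} f f-inj y with any? (λ x → f x ≟ y)
  ... | yes hit  = hit
  ... | no  miss = ⊥-elim (distinct (pigeonhole (n<1+n m) (λ x → punchOut (y≢f x))))
    where
    y≢f : ∀ x → y ≢ f x
    y≢f x eq = miss (x , sym eq)
    distinct : ¬ ∃₂ λ i j → i < j × punchOut (y≢f i) ≡ punchOut (y≢f j)
    distinct (i , j , i<j , eq) = <⇒≢ i<j (f-inj (punchOut-injective (y≢f i) (y≢f j) eq))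

  toPermutation : ∀ {n} (f : Fin n → Fin n) → Injective _≡_ _≡_ f → Permutation′ n
  toPermutation f f-inj =
    permutation f (proj₁ ∘ preimage) (proj₂ ∘ preimage) (λ x → f-inj (proj₂ (preimage (f x))))
    where
    preimage : ∀ y → ∃ λ x → f x ≡ y
    preimage = injective⇒surjective f f-inj

  ⟨$⟩ʳ-injective : ∀ {n} (π : Permutation′ n) → Injective _≡_ _≡_ (π ⟨$⟩ʳ_)
  ⟨$⟩ʳ-injective π {x} {y} eq = trans (sym (inverseˡ π)) (trans (cong (π ⟨$⟩ˡ_) eq) (inverseˡ π))

  transpose-invariant : ∀ {n} {X : Set} (f : Fin n → X) {i j} → f i ≡ f j →
                        ∀ k → f (PC.transpose i j k) ≡ f k
  transpose-invariant f {i} {j} fi≡fj k with k ≟ i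
  ... | yes refl = sym fi≡fj
  ... | no _ with k ≟ j
  ...   | yes refl = fi≡fj
  ...   | no _     = refl

-- The first-row expansion
-- Inv g = lead g + Inv (g ∘ suc) reduces lifted transpositions to shorter
-- sequences (lead is invariant under permuting the tail); the swap (0 1)
-- changes the count by one; (0 k) is (0 1) conjugating a lifted (0 k-1); and
-- a general (i j) is a lifted (i-1 j-1) or of the form (0 k).
module InversionParity where

  open import Data.Nat as ℕ using (zero; suc; _+_; _%_)
  open import Data.Nat.Properties as ℕₚ using (+-comm; +-assoc)
  open import Data.Parity.Base as ℙ using (0ℙ; 1ℙ; _⁻¹)
  open import Data.Parity.Properties using (⁻¹-involutive; p≢p⁻¹; +-homo-+)
  open import Data.Fin using (Fin; zero; suc; _<?_; _≟_)
  open import Data.Fin.Properties using (<-asym; ≤-antisym; suc-injective)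
  open import Data.Fin.Permutation using (_⟨$⟩ʳ_; transpose; lift₀; lift₀-transpose)
  import Data.Fin.Permutation.Components as PC
  open import Data.Bool using (Bool; true; false; not; _∧_; if_then_else_)
  open import Function using (_∘_; mk⇔; Injective)
  open import Relation.Nullary using (yes; no; does)
  open import Relation.Nullary.Decidable using (⌊_⌋; isYes≗does; does-⇔)
  open import Data.Empty using (⊥-elim)
  open import Relation.Binary.PropositionalEquality
  open import Algebra.Properties.CommutativeSemigroup ℕₚ.+-commutativeSemigroup using (x∙yz≈y∙xz)
  import Algebra.Properties.CommutativeMonoid.Sum ℕₚ.+-0-commutativeMonoid as ℕΣ

  open FiniteMaps using (⟨$⟩ʳ-injective)

  -- a and b have opposite parities (a record, so that a and b are inferable).
  record Opposite (a b : ℕ) : Set where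
    constructor opposite
    field parity-flipped : ℕ.parity a ≡ ℕ.parity b ⁻¹

  opposite-+ˡ : ∀ c {a b} → Opposite a b → Opposite (c + a) (c + b)
  opposite-+ˡ c {a} {b} (opposite opp) = opposite (begin
    ℕ.parity (c + a)                ≡⟨ +-homo-+ c a ⟩
    ℕ.parity c ℙ.+ ℕ.parity a       ≡⟨ cong (ℕ.parity c ℙ.+_) opp ⟩
    ℕ.parity c ℙ.+ ℕ.parity b ⁻¹    ≡⟨ +-⁻¹ʳ (ℕ.parity c) (ℕ.parity b) ⟩
    (ℕ.parity c ℙ.+ ℕ.parity b) ⁻¹  ≡⟨ cong _⁻¹ (+-homo-+ c b) ⟨
    ℕ.parity (c + b) ⁻¹             ∎)
    where
    open ≡-Reasoning
    +-⁻¹ʳ : ∀ p q → p ℙ.+ q ⁻¹ ≡ (p ℙ.+ q) ⁻¹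
    +-⁻¹ʳ 0ℙ q = refl
    +-⁻¹ʳ 1ℙ q = refl

  opposite-+ʳ : ∀ c {a b} → Opposite a b → Opposite (a + c) (b + c)
  opposite-+ʳ c {a} {b} opp = subst₂ Opposite (+-comm c a) (+-comm c b) (opposite-+ˡ c opp)

  opposite-chain : ∀ {a b c d} → Opposite a b → Opposite b c → Opposite c d → Opposite a d
  opposite-chain {a} {b} {c} {d} (opposite ab) (opposite bc) (opposite cd) = opposite (begin
    ℕ.parity a          ≡⟨ ab ⟩
    ℕ.parity b ⁻¹       ≡⟨ cong _⁻¹ bc ⟩
    ℕ.parity c ⁻¹ ⁻¹    ≡⟨ ⁻¹-involutive (ℕ.parity c) ⟩
    ℕ.parity c          ≡⟨ cd ⟩
    ℕ.parity d ⁻¹       ∎)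
    where open ≡-Reasoning

  opposite⇒%2≢ : ∀ {a b} → Opposite a b → a % 2 ≢ b % 2
  opposite⇒%2≢ {a} {b} (opposite opp) a≡b = p≢p⁻¹ (ℕ.parity b) (begin
    ℕ.parity b          ≡⟨ parity-%2 b ⟨
    ℕ.parity (b % 2)    ≡⟨ cong ℕ.parity a≡b ⟨
    ℕ.parity (a % 2)    ≡⟨ parity-%2 a ⟩
    ℕ.parity a          ≡⟨ opp ⟩
    ℕ.parity b ⁻¹       ∎)
    where
    open ≡-Reasoning
    parity-%2 : ∀ n → ℕ.parity (n % 2) ≡ ℕ.parity n
    parity-%2 zero          = refl
    parity-%2 (suc zero)    = refl
    parity-%2 (suc (suc n)) = parity-%2 n

  -- Inversions of an arbitrary sequence; inversions σ is Inv (σ ⟨$⟩ʳ_) by definition.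
  Inv : ∀ {n m} → (Fin n → Fin m) → ℕ
  Inv {n} g = sumℕ n (λ i → countFin n (λ j → ⌊ i <? j ⌋ ∧ ⌊ g j <? g i ⌋))

  lead : ∀ {n m} → (Fin (suc n) → Fin m) → ℕ
  lead {n} g = countFin n (λ j → ⌊ g (suc j) <? g zero ⌋)

  indicator : Bool → ℕ
  indicator b = if b then 1 else 0

  sumℕ-cong : ∀ n {f g : Fin n → ℕ} → (∀ i → f i ≡ g i) → sumℕ n f ≡ sumℕ n g
  sumℕ-cong zero    eq = refl
  sumℕ-cong (suc n) eq = cong₂ _+_ (eq zero) (sumℕ-cong n (eq ∘ suc))

  countFin-cong : ∀ n {P Q : Fin n → Bool} → (∀ i → P i ≡ Q i) → countFin n P ≡ countFin n Q
  countFin-cong zero    eq = refl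
  countFin-cong (suc n) eq = cong₂ _+_ (cong indicator (eq zero)) (countFin-cong n (eq ∘ suc))

  countFin-permute : ∀ n (P : Fin n → Bool) (π : Permutation′ n) →
                     countFin n (P ∘ (π ⟨$⟩ʳ_)) ≡ countFin n P
  countFin-permute n P π = begin
    countFin n (P ∘ (π ⟨$⟩ʳ_))          ≡⟨ countFin≡sum n (P ∘ (π ⟨$⟩ʳ_)) ⟩
    ℕΣ.sum (indicator ∘ P ∘ (π ⟨$⟩ʳ_))  ≡⟨ ℕΣ.sum-permute (indicator ∘ P) π ⟨
    ℕΣ.sum (indicator ∘ P)              ≡⟨ countFin≡sum n P ⟨
    countFin n P                        ∎
    where
    open ≡-Reasoning
    countFin≡sum : ∀ n (Q : Fin n → Bool) → countFin n Q ≡ ℕΣ.sum (indicator ∘ Q)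
    countFin≡sum zero    Q = refl
    countFin≡sum (suc n) Q = cong (indicator (Q zero) +_) (countFin≡sum n (Q ∘ suc))

  Inv-cong : ∀ {n m} {g h : Fin n → Fin m} → (∀ i → g i ≡ h i) → Inv g ≡ Inv h
  Inv-cong {n} eq = sumℕ-cong n λ i → countFin-cong n λ j →
    cong₂ (λ a b → ⌊ i <? j ⌋ ∧ ⌊ a <? b ⌋) (eq j) (eq i)

  Inv-unfold : ∀ {n m} (g : Fin (suc n) → Fin m) → Inv g ≡ lead g + Inv (g ∘ suc)
  Inv-unfold {n} g = cong (lead g +_) (sumℕ-cong n λ i → countFin-cong n λ j →
    cong (_∧ ⌊ g (suc j) <? g (suc i) ⌋) (<?-suc i j))
    where
    <?-suc : ∀ {k} (i j : Fin k) → ⌊ suc i <? suc j ⌋ ≡ ⌊ i <? j ⌋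
    <?-suc i j = begin
      ⌊ suc i <? suc j ⌋      ≡⟨ isYes≗does (suc i <? suc j) ⟩
      does (suc i <? suc j)   ≡⟨ does-⇔ (mk⇔ ℕ.s≤s⁻¹ ℕ.s≤s) (suc i <? suc j) (i <? j) ⟩
      does (i <? j)           ≡⟨ isYes≗does (i <? j) ⟨
      ⌊ i <? j ⌋              ∎
      where open ≡-Reasoning

  <?-flip : ∀ {m} (a b : Fin m) → a ≢ b → ⌊ a <? b ⌋ ≡ not ⌊ b <? a ⌋
  <?-flip a b a≢b with a <? b | b <? a
  ... | yes a<b | yes b<a = ⊥-elim (<-asym a<b b<a)
  ... | yes _   | no _    = refl
  ... | no _    | yes _   = refl
  ... | no a≮b  | no b≮a  = ⊥-elim (a≢b (≤-antisym (ℕₚ.≮⇒≥ b≮a) (ℕₚ.≮⇒≥ a≮b)))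

  opposite-indicator : ∀ b → Opposite (indicator (not b)) (indicator b)
  opposite-indicator true  = opposite refl
  opposite-indicator false = opposite refl

  -- Permuting the tail of a sequence changes the parity of its inversion
  -- count exactly as it changes that of the tail: the first row is unaffected.
  lift₀-flips : ∀ {n m} (g : Fin (suc n) → Fin m) (π : Permutation′ n) →
                Opposite (Inv (g ∘ suc ∘ (π ⟨$⟩ʳ_))) (Inv (g ∘ suc)) →
                Opposite (Inv (g ∘ (lift₀ π ⟨$⟩ʳ_))) (Inv g)
  lift₀-flips {n} g π opp =
    subst₂ Opposite (sym unfold-lifted) (sym (Inv-unfold g)) (opposite-+ˡ (lead g) opp)
    where
    unfold-lifted : Inv (g ∘ (lift₀ π ⟨$⟩ʳ_)) ≡ lead g + Inv (g ∘ suc ∘ (π ⟨$⟩ʳ_))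
    unfold-lifted = trans (Inv-unfold (g ∘ (lift₀ π ⟨$⟩ʳ_)))
      (cong (_+ Inv (g ∘ suc ∘ (π ⟨$⟩ʳ_))) (countFin-permute n (λ j → ⌊ g (suc j) <? g zero ⌋) π))

  swap₀₁ : ∀ {n} → Fin (suc (suc n)) → Fin (suc (suc n))
  swap₀₁ = PC.transpose zero (suc zero)

  -- Exchanging the first two (distinct) entries changes the inversion count by
  -- one: both counts are a comparison of g 0 with g 1 plus the same rest.
  swap₀₁-flips : ∀ {n m} (g : Fin (suc (suc n)) → Fin m) → g zero ≢ g (suc zero) →
                 Opposite (Inv (g ∘ swap₀₁)) (Inv g)
  swap₀₁-flips {n} g g₀≢g₁ = subst₂ Opposite (sym swapped) (sym original)
    (subst (λ b → Opposite (indicator b + rest) (indicator y + rest))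
           (sym (<?-flip (g zero) (g (suc zero)) g₀≢g₁))
           (opposite-+ʳ rest (opposite-indicator y)))
    where
    x y : Bool
    x = ⌊ g zero <? g (suc zero) ⌋
    y = ⌊ g (suc zero) <? g zero ⌋
    below₀ below₁ tail rest : ℕ
    below₀ = countFin n (λ j → ⌊ g (suc (suc j)) <? g zero ⌋)
    below₁ = countFin n (λ j → ⌊ g (suc (suc j)) <? g (suc zero) ⌋)
    tail = Inv (λ j → g (suc (suc j)))
    rest = below₁ + (below₀ + tail)
    swapped : Inv (g ∘ swap₀₁) ≡ indicator x + rest
    swapped = begin
      Inv (g ∘ swap₀₁)                                    ≡⟨ Inv-unfold (g ∘ swap₀₁) ⟩
      lead (g ∘ swap₀₁) + Inv (λ j → g (swap₀₁ (suc j)))  ≡⟨ cong (lead (g ∘ swap₀₁) +_) (Inv-unfold (λ j → g (swap₀₁ (suc j)))) ⟩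
      (indicator x + below₁) + (below₀ + tail)            ≡⟨ +-assoc (indicator x) below₁ (below₀ + tail) ⟩
      indicator x + rest                                  ∎
      where open ≡-Reasoning
    original : Inv g ≡ indicator y + rest
    original = begin
      Inv g                                       ≡⟨ Inv-unfold g ⟩
      lead g + Inv (g ∘ suc)                      ≡⟨ cong (lead g +_) (Inv-unfold (g ∘ suc)) ⟩
      (indicator y + below₀) + (below₁ + tail)    ≡⟨ +-assoc (indicator y) below₀ (below₁ + tail) ⟩
      indicator y + (below₀ + (below₁ + tail))    ≡⟨ cong (indicator y +_) (x∙yz≈y∙xz below₀ below₁ tail) ⟩
      indicator y + rest                          ∎
      where open ≡-Reasoning

  -- The transposition (0 k+2) is (0 1)(1 k+2)(0 1), and (1 k+2) is a lifted (0 k+1).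
  transpose₀-conjugate : ∀ {n} (k : Fin n) x →
    PC.transpose zero (suc (suc k)) x ≡ swap₀₁ (lift₀ (transpose zero (suc k)) ⟨$⟩ʳ swap₀₁ x)
  transpose₀-conjugate k zero          = refl
  transpose₀-conjugate k (suc zero)    = refl
  transpose₀-conjugate k (suc (suc y)) with does (y ≟ k)
  ... | true  = refl
  ... | false = refl

  transpose₀-flips : ∀ {n m} (g : Fin (suc n) → Fin m) → Injective _≡_ _≡_ g →
                     ∀ k → k ≢ zero → Opposite (Inv (g ∘ PC.transpose zero k)) (Inv g)
  transpose₀-flips g g-inj zero k≢0 = ⊥-elim (k≢0 refl)
  transpose₀-flips {suc n} g g-inj (suc zero) _ = swap₀₁-flips g (λ eq → 0≢1 (g-inj eq))
    where
    0≢1 : zero {suc n} ≢ suc zero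
    0≢1 ()
  transpose₀-flips {suc (suc n)} g g-inj (suc (suc k)) _ =
    subst (λ a → Opposite a (Inv g)) (Inv-cong (λ x → cong g (sym (transpose₀-conjugate k x))))
      (opposite-chain (swap₀₁-flips h (λ eq → 1≢k+2 (g-inj eq)))
                      (lift₀-flips g₁ π (transpose₀-flips (g₁ ∘ suc) g₁∘suc-inj (suc k) (λ ())))
                      (swap₀₁-flips g (λ eq → 0≢1 (g-inj eq))))
    where
    π : Permutation′ (suc (suc n))
    π = transpose zero (suc k)
    g₁ h : Fin (suc (suc (suc n))) → _
    g₁ = g ∘ swap₀₁
    h = g₁ ∘ (lift₀ π ⟨$⟩ʳ_)
    g₁∘suc-inj : Injective _≡_ _≡_ (g₁ ∘ suc)
    g₁∘suc-inj eq = suc-injective (⟨$⟩ʳ-injective (transpose zero (suc zero)) (g-inj eq))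
    0≢1 : zero {suc (suc n)} ≢ suc zero
    0≢1 ()
    1≢k+2 : suc zero ≢ suc (suc k)
    1≢k+2 ()

  transpose₀-symmetric : ∀ {n} (i : Fin n) x → PC.transpose (suc i) zero x ≡ PC.transpose zero (suc i) x
  transpose₀-symmetric i zero    = refl
  transpose₀-symmetric i (suc y) with does (y ≟ i)
  ... | true  = refl
  ... | false = refl

  -- Every transposition flips the parity of the inversion count of a sequence
  -- of distinct entries: reduce to (0 k) by lifting away common leading positions.
  transpose-flips : ∀ {n m} (g : Fin n → Fin m) → Injective _≡_ _≡_ g →
                    ∀ i j → i ≢ j → Opposite (Inv (g ∘ PC.transpose i j)) (Inv g)
  transpose-flips g g-inj zero    zero    i≢j = ⊥-elim (i≢j refl)
  transpose-flips g g-inj zero    (suc j) _   = transpose₀-flips g g-inj (suc j) (λ ())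
  transpose-flips g g-inj (suc i) zero    _   =
    subst (λ a → Opposite a (Inv g)) (Inv-cong (λ x → cong g (sym (transpose₀-symmetric i x))))
      (transpose₀-flips g g-inj (suc i) (λ ()))
  transpose-flips g g-inj (suc i) (suc j) i≢j =
    subst (λ a → Opposite a (Inv g)) (Inv-cong (λ x → cong g (sym (lift₀-transpose i j x))))
      (lift₀-flips g (transpose i j)
        (transpose-flips (g ∘ suc) (suc-injective ∘ g-inj) i j (i≢j ∘ cong suc)))

  parity-transpose : ∀ {n} (ρ : Permutation′ n) {i j} → i ≢ j →
                     parity (transpose i j ∘ₚ ρ) ≢ parity ρ
  parity-transpose ρ {i} {j} i≢j =
    opposite⇒%2≢ (transpose-flips (ρ ⟨$⟩ʳ_) (⟨$⟩ʳ-injective ρ) i j i≢j)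

module TropicalPermanent (R : RealNumbers) where
  open import Level using (0ℓ)
  open import Data.Nat using (zero; suc)
  open import Data.Fin using (Fin; zero; suc; punchIn; _≟_)
  open import Data.Fin.Permutation
    using (_⟨$⟩ʳ_; _⟨$⟩ˡ_; _≈_; id; flip; insert; remove; insert-remove; inverseˡ; inverseʳ; transpose)
  import Data.Fin.Permutation.Components as PC
  open import Data.Product using (∃; proj₁; proj₂)
  open import Data.Sum using (inj₁; inj₂)
  open import Data.Empty using (⊥-elim)
  open import Function using (_∘_; Injective)
  open import Relation.Nullary using (yes; no)
  open import Relation.Binary.PropositionalEquality
  open import Algebra.Bundles using (CommutativeMonoid)
  import Algebra.Properties.CommutativeMonoid.Sum as MonoidSum
  open InversionParity using (parity-transpose)
  open FiniteMaps using (transpose-invariant; toPermutation)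
  open RealNumbers R
  open Tropical R
  open TropicalSign R

  ≤-reflexive : ∀ {x y} → x ≡ y → x ≤ y
  ≤-reflexive {x} refl = ≤-refl x

  +-mono-≤ : ∀ {a b c d} → a ≤ b → c ≤ d → a + c ≤ b + d
  +-mono-≤ {a} {b} {c} {d} a≤b c≤d = ≤-trans (+-monoˡ-≤ c a≤b)
    (subst₂ _≤_ (+-comm c b) (+-comm d b) (+-monoˡ-≤ b c≤d))

  -- (ℝ, +, 0) as a library commutative monoid, to reuse its finite sums.
  +-0-commutativeMonoid : CommutativeMonoid 0ℓ 0ℓ
  +-0-commutativeMonoid = record
    { Carrier = ℝ ; _≈_ = _≡_ ; _∙_ = _+_ ; ε = 0ℝ
    ; isCommutativeMonoid = record
      { isMonoid = record
        { isSemigroup = record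
          { isMagma = record { isEquivalence = isEquivalence ; ∙-cong = cong₂ _+_ }
          ; assoc = +-assoc }
        ; identity = (λ x → trans (+-comm 0ℝ x) (+-identityʳ x)) , +-identityʳ }
      ; comm = +-comm } }

  open MonoidSum +-0-commutativeMonoid using (sum; sum-permute; ∑-distrib-+)

  sumFin≡sum : ∀ n (f : Fin n → ℝ) → sumFin n f ≡ sum f
  sumFin≡sum zero    f = refl
  sumFin≡sum (suc n) f = cong (f zero +_) (sumFin≡sum n (f ∘ suc))

  sumFin-permute : ∀ n (f : Fin n → ℝ) (π : Permutation′ n) → sumFin n (f ∘ (π ⟨$⟩ʳ_)) ≡ sumFin n f
  sumFin-permute n f π = begin
    sumFin n (f ∘ (π ⟨$⟩ʳ_))  ≡⟨ sumFin≡sum n (f ∘ (π ⟨$⟩ʳ_)) ⟩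
    sum (f ∘ (π ⟨$⟩ʳ_))       ≡⟨ sum-permute f π ⟨
    sum f                     ≡⟨ sumFin≡sum n f ⟨
    sumFin n f                ∎
    where open ≡-Reasoning

  sumFin-+ : ∀ n (f g : Fin n → ℝ) → sumFin n (λ i → f i + g i) ≡ sumFin n f + sumFin n g
  sumFin-+ n f g = begin
    sumFin n (λ i → f i + g i)  ≡⟨ sumFin≡sum n _ ⟩
    sum (λ i → f i + g i)       ≡⟨ ∑-distrib-+ f g ⟩
    sum f + sum g               ≡⟨ cong₂ _+_ (sumFin≡sum n f) (sumFin≡sum n g) ⟨
    sumFin n f + sumFin n g     ∎
    where open ≡-Reasoning

  sumFin-cong : ∀ n {f g : Fin n → ℝ} → (∀ i → f i ≡ g i) → sumFin n f ≡ sumFin n g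
  sumFin-cong zero    eq = refl
  sumFin-cong (suc n) eq = cong₂ _+_ (eq zero) (sumFin-cong n (eq ∘ suc))

  sumFin-mono : ∀ n {f g : Fin n → ℝ} → (∀ i → f i ≤ g i) → sumFin n f ≤ sumFin n g
  sumFin-mono zero    le = ≤-refl 0ℝ
  sumFin-mono (suc n) le = +-mono-≤ (le zero) (sumFin-mono n (le ∘ suc))

  weight-cong : ∀ {n} (M : Matrix n) (π ρ : Permutation′ n) → π ≈ ρ → weight M π ≡ weight M ρ
  weight-cong {n} M π ρ eq = sumFin-cong n (cong (M _) ∘ eq)

  min-≤ˡ : ∀ a b → min a b ≤ a
  min-≤ˡ a b with ≤-total a b
  ... | inj₁ _   = ≤-refl a
  ... | inj₂ b≤a = b≤a

  min-≤ʳ : ∀ a b → min a b ≤ b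
  min-≤ʳ a b with ≤-total a b
  ... | inj₁ a≤b = a≤b
  ... | inj₂ _   = ≤-refl b

  minFin-≤ : ∀ m (f : Fin (suc m) → ℝ) t → minFin m f ≤ f t
  minFin-≤ zero    f zero    = ≤-refl (f zero)
  minFin-≤ (suc m) f zero    = min-≤ˡ (f zero) (minFin m (f ∘ suc))
  minFin-≤ (suc m) f (suc t) = ≤-trans (min-≤ʳ (f zero) (minFin m (f ∘ suc))) (minFin-≤ m (f ∘ suc) t)

  minFin-attained : ∀ m (f : Fin (suc m) → ℝ) → ∃ λ t → minFin m f ≡ f t
  minFin-attained zero    f = zero , refl
  minFin-attained (suc m) f with ≤-total (f zero) (minFin m (f ∘ suc))
  ... | inj₁ _ = zero , refl
  ... | inj₂ _ with t , eq ← minFin-attained m (f ∘ suc) = suc t , eq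

  argmin : ∀ m (f : Fin (suc m) → ℝ) → ∃ λ k → ∀ t → f k ≤ f t
  argmin m f with k , eq ← minFin-attained m f = k , λ t → subst (_≤ f t) eq (minFin-≤ m f t)

  -- Every function on permutations that respects pointwise equality attains
  -- its minimum: a permutation of suc m is determined by its value at 0 and
  -- a permutation of m (insert/remove), so minimise over both in turn.
  minimiser : ∀ n (W : Permutation′ n → ℝ) → (∀ π ρ → π ≈ ρ → W π ≡ W ρ) →
              ∃ λ σ → ∀ ρ → W σ ≤ W ρ
  minimiser zero    W W-cong = id , λ ρ → ≤-reflexive (W-cong id ρ (λ ()))
  minimiser (suc m) W W-cong = insert zero k (best k) , optimal
    where
    insert₀-cong : ∀ k {π ρ : Permutation′ m} → π ≈ ρ → insert zero k π ≈ insert zero k ρ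
    insert₀-cong k eq zero    = refl
    insert₀-cong k eq (suc x) = cong (punchIn k) (eq x)
    cheapest : ∀ k → ∃ λ σ → ∀ ρ → W (insert zero k σ) ≤ W (insert zero k ρ)
    cheapest k = minimiser m (W ∘ insert zero k) (λ π ρ → W-cong _ _ ∘ insert₀-cong k)
    best : Fin (suc m) → Permutation′ m
    best k = proj₁ (cheapest k)
    best-k : ∃ λ k → ∀ t → W (insert zero k (best k)) ≤ W (insert zero t (best t))
    best-k = argmin m (λ k → W (insert zero k (best k)))
    k : Fin (suc m)
    k = proj₁ best-k
    optimal : ∀ ρ → W (insert zero k (best k)) ≤ W ρ
    optimal ρ = ≤-trans (proj₂ best-k (ρ ⟨$⟩ʳ zero))
               (≤-trans (proj₂ (cheapest (ρ ⟨$⟩ʳ zero)) (remove zero ρ))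
                        (≤-reflexive (W-cong _ ρ (insert-remove zero ρ))))

  product-≤ : ∀ {n} (A B : Matrix n) i j t → (A ⊗ B) i j ≤ A i t + B t j
  product-≤ {suc m} A B i j = minFin-≤ m (λ t → A i t + B t j)

  product-attained : ∀ {n} (A B : Matrix n) i j → ∃ λ t → (A ⊗ B) i j ≡ A i t + B t j
  product-attained {suc m} A B i j = minFin-attained m (λ t → A i t + B t j)

  module Product {n} (A B : Matrix n) where

    routed : (Fin n → Fin n) → Permutation′ n → ℝ
    routed f ρ = sumFin n (λ i → A i (f i)) + sumFin n (λ i → B (f i) (ρ ⟨$⟩ʳ i))

    weight-≤-routed : ∀ ρ f → weight (A ⊗ B) ρ ≤ routed f ρ
    weight-≤-routed ρ f = ≤-trans (sumFin-mono n (λ i → product-≤ A B i (ρ ⟨$⟩ʳ i) (f i)))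
                                  (≤-reflexive (sumFin-+ n _ _))

    witness : Permutation′ n → Fin n → Fin n
    witness ρ i = proj₁ (product-attained A B i (ρ ⟨$⟩ʳ i))

    weight-≡-routed : ∀ ρ → weight (A ⊗ B) ρ ≡ routed (witness ρ) ρ
    weight-≡-routed ρ = trans (sumFin-cong n (λ i → proj₂ (product-attained A B i (ρ ⟨$⟩ʳ i))))
                              (sumFin-+ n _ _)

    routed-permutation : ∀ φ ρ → routed (φ ⟨$⟩ʳ_) ρ ≡ weight A φ + weight B (flip φ ∘ₚ ρ)
    routed-permutation φ ρ = cong (weight A φ +_) (begin
      sumFin n (λ i → B (φ ⟨$⟩ʳ i) (ρ ⟨$⟩ʳ i))
        ≡⟨ sumFin-cong n (λ i → cong (λ k → B (φ ⟨$⟩ʳ i) (ρ ⟨$⟩ʳ k)) (inverseˡ φ)) ⟨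
      sumFin n (λ i → B (φ ⟨$⟩ʳ i) (ρ ⟨$⟩ʳ (φ ⟨$⟩ˡ (φ ⟨$⟩ʳ i))))
        ≡⟨ sumFin-permute n (λ t → B t (ρ ⟨$⟩ʳ (φ ⟨$⟩ˡ t))) φ ⟩
      weight B (flip φ ∘ₚ ρ)
        ∎)
      where open ≡-Reasoning

    routed-transpose : ∀ f ρ {i j} → f i ≡ f j → routed f (transpose i j ∘ₚ ρ) ≡ routed f ρ
    routed-transpose f ρ {i} {j} fi≡fj = cong (sumFin n (λ k → A k (f k)) +_) (begin
      sumFin n (λ k → B (f k) (ρ ⟨$⟩ʳ PC.transpose i j k))
        ≡⟨ sumFin-cong n (λ k → cong (λ t → B t _) (transpose-invariant f fi≡fj k)) ⟨
      sumFin n (λ k → B (f (PC.transpose i j k)) (ρ ⟨$⟩ʳ PC.transpose i j k))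
        ≡⟨ sumFin-permute n (λ k → B (f k) (ρ ⟨$⟩ʳ k)) (transpose i j) ⟩
      sumFin n (λ k → B (f k) (ρ ⟨$⟩ʳ k))
        ∎)
      where open ≡-Reasoning

    -- Upper bound: route σ ∘ₚ τ through σ.
    product-weight-≤ : ∀ σ τ → weight (A ⊗ B) (σ ∘ₚ τ) ≤ weight A σ + weight B τ
    product-weight-≤ σ τ = ≤-trans (weight-≤-routed (σ ∘ₚ τ) (σ ⟨$⟩ʳ_)) (≤-reflexive (begin
      routed (σ ⟨$⟩ʳ_) (σ ∘ₚ τ)                ≡⟨ routed-permutation σ (σ ∘ₚ τ) ⟩
      weight A σ + weight B (flip σ ∘ₚ σ ∘ₚ τ)  ≡⟨ cong (weight A σ +_) (weight-cong B (flip σ ∘ₚ σ ∘ₚ τ) τ (λ t → cong (τ ⟨$⟩ʳ_) (inverseʳ σ))) ⟩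
      weight A σ + weight B τ                   ∎))
      where open ≡-Reasoning

    -- When A ⊗ B is sign-nonsingular, the witnesses of an optimal permutation ρ
    -- are distinct: otherwise composing ρ with the transposition of two rows
    -- sharing a witness gives an optimal permutation of the other parity.
    witness-injective : SignNonsingular (A ⊗ B) → ∀ ρ → ρ ∈Σ (A ⊗ B) → Injective _≡_ _≡_ (witness ρ)
    witness-injective sns ρ ρ-opt {i} {j} fi≡fj with i ≟ j
    ... | yes i≡j = i≡j
    ... | no  i≢j = ⊥-elim (parity-transpose ρ i≢j (sns (transpose i j ∘ₚ ρ) ρ swapped-opt ρ-opt))
      where
      swapped-opt : (transpose i j ∘ₚ ρ) ∈Σ (A ⊗ B)
      swapped-opt π = ≤-trans (weight-≤-routed (transpose i j ∘ₚ ρ) (witness ρ))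
        (≤-trans (≤-reflexive (trans (routed-transpose (witness ρ) ρ fi≡fj) (sym (weight-≡-routed ρ))))
                 (ρ-opt π))

    -- Lower bound: an optimal ρ₀ for A ⊗ B is routed through a permutation.
    product-weight-≥ : SignNonsingular (A ⊗ B) → ∀ σ τ → σ ∈Σ A → τ ∈Σ B →
                       ∀ ρ → weight A σ + weight B τ ≤ weight (A ⊗ B) ρ
    product-weight-≥ sns σ τ σ-opt τ-opt ρ =
      ≤-trans (+-mono-≤ (σ-opt φ) (τ-opt (flip φ ∘ₚ ρ₀)))
        (≤-trans (≤-reflexive (sym (trans (weight-≡-routed ρ₀) (routed-permutation φ ρ₀))))
                 (ρ₀-opt ρ))
      where
      optimum : ∃ λ ρ₀ → ρ₀ ∈Σ (A ⊗ B)
      optimum = minimiser n (weight (A ⊗ B)) (weight-cong (A ⊗ B))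
      ρ₀ : Permutation′ n
      ρ₀ = proj₁ optimum
      ρ₀-opt : ρ₀ ∈Σ (A ⊗ B)
      ρ₀-opt = proj₂ optimum
      φ : Permutation′ n
      φ = toPermutation (witness ρ₀) (witness-injective sns ρ₀ ρ₀-opt)

mainTheorem2 : (R : RealNumbers) → (n : ℕ) →
    (A B : Tropical.Matrix R n) →
    TropicalSign.SignNonsingular R (Tropical._⊗_ R A B) →
    (σ τ : Permutation′ n) →
    Tropical._∈Σ_ R σ A → Tropical._∈Σ_ R τ B →
    Tropical._∈Σ_ R (σ ∘ₚ τ) (Tropical._⊗_ R A B)
    × (∀ p q r → Tropical.IsPerm R A p → Tropical.IsPerm R B q →
         Tropical.IsPerm R (Tropical._⊗_ R A B) r → RealNumbers._+_ R p q ≡ r)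
mainTheorem2 R n A B sns σ τ σ-opt τ-opt = composite-optimal , permanents-add
  where
  open RealNumbers R
  open Tropical R
  open TropicalPermanent R
  open Product A B

  composite-optimal : (σ ∘ₚ τ) ∈Σ (A ⊗ B)
  composite-optimal ρ = ≤-trans (product-weight-≤ σ τ) (product-weight-≥ sns σ τ σ-opt τ-opt ρ)

  permanents-add : ∀ p q r → IsPerm A p → IsPerm B q → IsPerm (A ⊗ B) r → p + q ≡ r
  permanents-add _ _ _ ((σ′ , refl) , σ′-opt) ((τ′ , refl) , τ′-opt) ((ρ′ , refl) , ρ′-opt) =
    ≤-antisym (product-weight-≥ sns σ′ τ′ σ′-opt τ′-opt ρ′)
              (≤-trans (ρ′-opt (σ′ ∘ₚ τ′)) (product-weight-≤ σ′ τ′))
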